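{- Let $a\ge 2$ be an integer and $n$ a positive integer. If $a$ is even, then $N(a, D_n) = N(a, C_n)$. If $a$ is odd, then $N(a, D_n) = n + N(a, C_n)$.
   Context: $D_n$ is the dihedral group of order $2n$ and $C_n$ is the cyclic group of order $n$. For a finite group $H$ and integer $a\ge 2$, $G(a,H)$ is the undirected multigraph on vertex set $H$ with an edge between $x$ and $y$ whenever $x^a=y$ (an additional edge if also $y^a=x$; loops allowed), and $N(a,H)$ is its number of connected components, equivalently the number of cycles of the map $x\mapsto x^a$ on $H$. -}

module Defs where

open import Data.Nat using (ℕ; zero; suc; _+_; _∸_; _%_; _<_; _<?_; NonZero)
open import Data.Nat.DivMod using (m%n<n)
open import Data.Bool using (Bool; true; false; _xor_)
import Data.Bool.Properties as BoolP
open import Data.Fin using (Fin; toℕ; fromℕ<; splitAt)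
import Data.Fin.Properties as FinP
open import Data.Fin.Properties using (any?; all?)
open import Data.Product using (_×_; _,_; ∃)
open import Data.Product.Properties using (≡-dec)
open import Data.Sum using (inj₁; inj₂)
open import Data.List using (length; filter; allFin)
open import Relation.Binary.PropositionalEquality using (_≡_)
open import Relation.Binary.Definitions using (DecidableEquality)
open import Relation.Nullary using (¬_)
open import Relation.Nullary.Decidable using (_→-dec_; ¬?; _×-dec_)

iter : {A : Set} → (A → A) → ℕ → A → A
iter f zero    x = x
iter f (suc k) x = f (iter f k x)

pow : {A : Set} → (A → A → A) → A → A → ℕ → A
pow _·_ e x zero    = e
pow _·_ e x (suc k) = x · pow _·_ e x k

-- Number of cycles of a map f on a finite set A, given an enumeration
-- enum : Fin m → A (intended to be a bijection) and decidable equality.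
-- A cycle is counted at its element of least enumeration index:
-- i is counted iff enum i is periodic (f^k x = x for some 1 ≤ k ≤ m)
-- and no enum j with j < i lies in the forward orbit {f^t x | t < m}.

module _ {A : Set} (_≟_ : DecidableEquality A) (m : ℕ) (enum : Fin m → A) (f : A → A) where

  Periodic : A → Set
  Periodic x = ∃ λ (k : Fin m) → iter f (suc (toℕ k)) x ≡ x

  periodic? : (x : A) → Relation.Nullary.Dec (Periodic x)
  periodic? x = any? (λ k → iter f (suc (toℕ k)) x ≟ x)

  Leader : Fin m → Set
  Leader i = Periodic (enum i) ×
    ((t j : Fin m) → toℕ j < toℕ i → ¬ (enum j ≡ iter f (toℕ t) (enum i)))

  leader? : (i : Fin m) → Relation.Nullary.Dec (Leader i)
  leader? i = periodic? (enum i) ×-dec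
    all? (λ t → all? (λ j → (toℕ j <? toℕ i) →-dec ¬? (enum j ≟ iter f (toℕ t) (enum i))))

  numCycles : ℕ
  numCycles = length (filter leader? (allFin m))

module _ (n : ℕ) .{{_ : NonZero n}} where

  addC : Fin n → Fin n → Fin n
  addC x y = fromℕ< (m%n<n (toℕ x + toℕ y) n)

  negC : Fin n → Fin n
  negC x = fromℕ< (m%n<n (n ∸ toℕ x) n)

  zeroC : Fin n
  zeroC = fromℕ< (m%n<n 0 n)

  -- Dihedral group D_n of order 2n: (e , k) stands for s^e r^k,
  -- with r^n = 1, s^2 = 1, r^k s = s r^{-k}, so
  -- (s^e₁ r^k₁)(s^e₂ r^k₂) = s^(e₁+e₂) r^((-1)^e₂ k₁ + k₂).
  D : Set
  D = Bool × Fin n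

  mulD : D → D → D
  mulD (e₁ , k₁) (false , k₂) = (e₁ xor false , addC k₁ k₂)
  mulD (e₁ , k₁) (true  , k₂) = (e₁ xor true  , addC (negC k₁) k₂)

  oneD : D
  oneD = (false , zeroC)

  _≟D_ : DecidableEquality D
  _≟D_ = ≡-dec BoolP._≟_ FinP._≟_

  enumD : Fin (n + n) → D
  enumD i with splitAt n i
  ... | inj₁ k = (false , k)
  ... | inj₂ k = (true  , k)

  NC : ℕ → ℕ
  NC a = numCycles FinP._≟_ n (λ i → i) (λ x → pow addC zeroC x a)

  ND : ℕ → ℕ
  ND a = numCycles _≟D_ (n + n) enumD (λ x → pow mulD oneD x a)

module Submission where

-- The a-th power map sends the rotation r^k to r^(ka), so on rotations it is the
-- a-th power map of C_n and they contribute exactly N(a, C_n) cycles. A reflection s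
-- satisfies s² = 1, so s^a = 1 for even a (s lies on no cycle, since rotations never
-- leave the rotations) and s^a = s for odd a (each of the n reflections is a cycle).

open import Data.Nat using (ℕ; zero; suc; _+_; _*_; _∸_; _/_; _%_; _≤_; _<_; z≤n; s≤s; NonZero)
open import Data.Nat.Properties
  using (n<1+n; ≤-reflexive; <⇒≤; ≤-<-trans; <-≤-trans; <-irrefl; +-monoʳ-<; m∸n+n≡m;
         m≤n⇒m<n∨m≡n; +-identityʳ; +-comm)
open import Data.Nat.DivMod using (m%n<n; m≡m%n+[m/n]*n; m<n⇒m%n≡m; %-distribˡ-+; n%n≡0)
open import Data.Nat.Divisibility using (_∣_; divides; m%n≡0⇒n∣m)
open import Data.Bool using (true; false)
open import Data.Fin using (Fin; toℕ; fromℕ<; zero; suc; _↑ˡ_; _↑ʳ_; splitAt)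
import Data.Fin.Properties as FinP
open import Data.Product using (_×_; _,_; ∃; ∃-syntax)
open import Data.Sum using (inj₁; inj₂)
open import Data.List using ([]; _∷_; _++_; map; length; filter; tabulate; allFin)
open import Data.List.Properties
  using (length-++; length-tabulate; map-tabulate; filter-++; filter-≐; filter-all; filter-none)
open import Data.List.Relation.Unary.All.Properties using (tabulate⁺)
open import Relation.Nullary using (¬_; does; contradiction)
open import Relation.Unary using (Pred; Decidable)
open import Relation.Binary.PropositionalEquality
  using (_≡_; refl; sym; trans; cong; cong₂; subst₂; module ≡-Reasoning)
open import Function using (_∘_)

open import Defs

open ≡-Reasoning

module _ {A : Set} (f : A → A) where

  iter-+ : ∀ r s x → iter f (r + s) x ≡ iter f r (iter f s x)
  iter-+ zero    s x = refl
  iter-+ (suc r) s x = cong f (iter-+ r s x)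

  iter-sucʳ : ∀ k x → iter f (suc k) x ≡ iter f k (f x)
  iter-sucʳ zero    x = refl
  iter-sucʳ (suc k) x = cong f (iter-sucʳ k x)

  iter-fixed : ∀ {x} → f x ≡ x → ∀ t → iter f t x ≡ x
  iter-fixed fx≡x zero    = refl
  iter-fixed fx≡x (suc t) = trans (cong f (iter-fixed fx≡x t)) fx≡x

  iter-shift : ∀ {i j} x k → iter f i x ≡ iter f j x → iter f (k + j) x ≡ iter f (k + i) x
  iter-shift {i} {j} x k eq = begin
    iter f (k + j) x       ≡⟨ iter-+ k j x ⟩
    iter f k (iter f j x)  ≡⟨ cong (iter f k) eq ⟨
    iter f k (iter f i x)  ≡⟨ iter-+ k i x ⟨
    iter f (k + i) x       ∎

iter-semiconj : ∀ {A B : Set} {f : A → A} {g : B → B} (h : B → A) →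
  (∀ y → f (h y) ≡ h (g y)) → ∀ t y → iter f t (h y) ≡ h (iter g t y)
iter-semiconj h comm zero    y = refl
iter-semiconj {f = f} h comm (suc t) y = trans (cong f (iter-semiconj h comm t y)) (comm _)

module _ {n : ℕ} (f : Fin n → Fin n) where

  -- Pigeonhole on x, f x, …, fⁿ x gives i < j ≤ n with fⁱ x = fʲ x; shift by n ∸ j.
  iter-n-within : ∀ x → ∃[ s ] s < n × iter f n x ≡ iter f s x
  iter-n-within x with i , j , i<j , eq ← FinP.pigeonhole (n<1+n n) (λ t → iter f (toℕ t) x) =
    n ∸ toℕ j + toℕ i , bound ,
    trans (cong (λ u → iter f u x) (sym n∸j+j≡n)) (iter-shift f x (n ∸ toℕ j) eq)
    where
    n∸j+j≡n : n ∸ toℕ j + toℕ j ≡ n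
    n∸j+j≡n = m∸n+n≡m (FinP.toℕ≤pred[n] j)
    bound : n ∸ toℕ j + toℕ i < n
    bound = <-≤-trans (+-monoʳ-< (n ∸ toℕ j) i<j) (≤-reflexive n∸j+j≡n)

  iter-within : ∀ x t → ∃[ s ] s < n × iter f t x ≡ iter f s x
  iter-within x zero = 0 , ≤-<-trans z≤n (FinP.toℕ<n x) , refl
  iter-within x (suc t) with s , s<n , eq ← iter-within x t with m≤n⇒m<n∨m≡n s<n
  ... | inj₁ 1+s<n = suc s , 1+s<n , cong f eq
  ... | inj₂ refl with s′ , s′<n , eq′ ← iter-n-within x = s′ , s′<n , trans (cong f eq) eq′

  period-within : ∀ x k → iter f (suc k) x ≡ x → ∃ λ (p : Fin n) → iter f (suc (toℕ p)) x ≡ x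
  period-within x k periodic with s , s<n , eq ← iter-within (f x) k = fromℕ< s<n , (begin
    iter f (suc (toℕ (fromℕ< s<n))) x  ≡⟨ cong (λ u → iter f (suc u) x) (FinP.toℕ-fromℕ< s<n) ⟩
    iter f (suc s) x                   ≡⟨ iter-sucʳ f s x ⟩
    iter f s (f x)                     ≡⟨ eq ⟨
    iter f k (f x)                     ≡⟨ iter-sucʳ f k x ⟨
    iter f (suc k) x                   ≡⟨ periodic ⟩
    x                                  ∎)

¬2∣m⇒m≡1+[m/2]*2 : ∀ m → ¬ 2 ∣ m → m ≡ suc (m / 2 * 2)
¬2∣m⇒m≡1+[m/2]*2 m 2∤m with m % 2 in eq | m%n<n m 2
... | 0 | _ = contradiction (m%n≡0⇒n∣m m 2 eq) 2∤m
... | 1 | _ = trans (m≡m%n+[m/n]*n m 2) (cong (_+ m / 2 * 2) eq)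
... | suc (suc _) | s≤s (s≤s ())

module _ {A B : Set} {p} {P : Pred B p} (P? : Decidable P) (f : A → B) where

  length-filter-map : ∀ xs → length (filter P? (map f xs)) ≡ length (filter (P? ∘ f) xs)
  length-filter-map []       = refl
  length-filter-map (x ∷ xs) with does (P? (f x))
  ... | true  = cong suc (length-filter-map xs)
  ... | false = length-filter-map xs

tabulate-+ : ∀ {A : Set} m n (g : Fin (m + n) → A) →
  tabulate g ≡ tabulate (g ∘ (_↑ˡ n)) ++ tabulate (g ∘ (m ↑ʳ_))
tabulate-+ zero    n g = refl
tabulate-+ (suc m) n g = cong (g zero ∷_) (tabulate-+ m n (g ∘ suc))

length-filter-allFin-+ : ∀ m n {p} {P : Pred (Fin (m + n)) p} (P? : Decidable P) →
  length (filter P? (allFin (m + n))) ≡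
  length (filter (P? ∘ (_↑ˡ n)) (allFin m)) + length (filter (P? ∘ (m ↑ʳ_)) (allFin n))
length-filter-allFin-+ m n P? = begin
  length (filter P? (allFin (m + n)))
    ≡⟨ cong (length ∘ filter P?) (tabulate-+ m n (λ i → i)) ⟩
  length (filter P? (tabulate (_↑ˡ n) ++ tabulate (m ↑ʳ_)))
    ≡⟨ cong length (filter-++ P? (tabulate (_↑ˡ n)) _) ⟩
  length (filter P? (tabulate (_↑ˡ n)) ++ filter P? (tabulate (m ↑ʳ_)))
    ≡⟨ length-++ (filter P? (tabulate (_↑ˡ n))) ⟩
  length (filter P? (tabulate (_↑ˡ n))) + length (filter P? (tabulate (m ↑ʳ_)))
    ≡⟨ cong₂ _+_ (count-tabulate (_↑ˡ n)) (count-tabulate (m ↑ʳ_)) ⟩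
  length (filter (P? ∘ (_↑ˡ n)) (allFin m)) + length (filter (P? ∘ (m ↑ʳ_)) (allFin n)) ∎
  where
  count-tabulate : ∀ {k} (g : Fin k → Fin (m + n)) →
    length (filter P? (tabulate g)) ≡ length (filter (P? ∘ g) (allFin k))
  count-tabulate g = trans (cong (length ∘ filter P?) (sym (map-tabulate (λ i → i) g)))
                           (length-filter-map P? g (allFin _))

module Dihedral (n : ℕ) .{{_ : NonZero n}} where

  rotation reflection : Fin n → D n
  rotation   k = false , k
  reflection k = true , k

  _^C_ : Fin n → ℕ → Fin n
  x ^C b = pow (addC n) (zeroC n) x b

  _^D_ : D n → ℕ → D n
  x ^D b = pow (mulD n) (oneD n) x b

  toℕ-zeroC : toℕ (zeroC n) ≡ 0
  toℕ-zeroC = trans (FinP.toℕ-fromℕ< _) (m<n⇒m%n≡m (≤-<-trans z≤n (FinP.toℕ<n (zeroC n))))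

  addC-identityʳ : ∀ k → addC n k (zeroC n) ≡ k
  addC-identityʳ k = FinP.toℕ-injective (begin
    toℕ (addC n k (zeroC n))    ≡⟨ FinP.toℕ-fromℕ< _ ⟩
    (toℕ k + toℕ (zeroC n)) % n ≡⟨ cong (λ u → (toℕ k + u) % n) toℕ-zeroC ⟩
    (toℕ k + 0) % n             ≡⟨ cong (_% n) (+-identityʳ (toℕ k)) ⟩
    toℕ k % n                   ≡⟨ m<n⇒m%n≡m (FinP.toℕ<n k) ⟩
    toℕ k                       ∎)

  addC-inverseˡ : ∀ k → addC n (negC n k) k ≡ zeroC n
  addC-inverseˡ k = FinP.toℕ-injective (begin
    toℕ (addC n (negC n k) k)           ≡⟨ FinP.toℕ-fromℕ< _ ⟩
    (toℕ (negC n k) + toℕ k) % n        ≡⟨ cong (λ u → (u + toℕ k) % n) (FinP.toℕ-fromℕ< _) ⟩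
    ((n ∸ toℕ k) % n + toℕ k) % n       ≡⟨ cong (λ u → ((n ∸ toℕ k) % n + u) % n) (m<n⇒m%n≡m (FinP.toℕ<n k)) ⟨
    ((n ∸ toℕ k) % n + toℕ k % n) % n   ≡⟨ %-distribˡ-+ (n ∸ toℕ k) (toℕ k) n ⟨
    (n ∸ toℕ k + toℕ k) % n             ≡⟨ cong (_% n) (m∸n+n≡m (<⇒≤ (FinP.toℕ<n k))) ⟩
    n % n                               ≡⟨ n%n≡0 n ⟩
    0                                   ≡⟨ toℕ-zeroC ⟨
    toℕ (zeroC n)                       ∎)

  rotation-^ : ∀ k b → rotation k ^D b ≡ rotation (k ^C b)
  rotation-^ k zero    = refl
  rotation-^ k (suc b) = cong (mulD n (rotation k)) (rotation-^ k b)

  reflection-^-even : ∀ k m → reflection k ^D (m * 2) ≡ oneD n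
  reflection-^-even k zero    = refl
  reflection-^-even k (suc m) = begin
    mulD n (reflection k) (mulD n (reflection k) (reflection k ^D (m * 2)))
      ≡⟨ cong (λ x → mulD n (reflection k) (mulD n (reflection k) x)) (reflection-^-even k m) ⟩
    mulD n (reflection k) (reflection (addC n k (zeroC n)))
      ≡⟨ cong (mulD n (reflection k) ∘ reflection) (addC-identityʳ k) ⟩
    rotation (addC n (negC n k) k)
      ≡⟨ cong rotation (addC-inverseˡ k) ⟩
    oneD n ∎

  reflection-^-odd : ∀ k m → reflection k ^D suc (m * 2) ≡ reflection k
  reflection-^-odd k m = begin
    mulD n (reflection k) (reflection k ^D (m * 2)) ≡⟨ cong (mulD n (reflection k)) (reflection-^-even k m) ⟩
    reflection (addC n k (zeroC n))                 ≡⟨ cong reflection (addC-identityʳ k) ⟩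
    reflection k                                    ∎

  indexD : D n → Fin (n + n)
  indexD (false , k) = k ↑ˡ n
  indexD (true  , k) = n ↑ʳ k

  indexD-enumD : ∀ i → indexD (enumD n i) ≡ i
  indexD-enumD i with splitAt n i in eq
  ... | inj₁ k = FinP.splitAt⁻¹-↑ˡ eq
  ... | inj₂ k = FinP.splitAt⁻¹-↑ʳ eq

  enumD-injective : ∀ {i j} → enumD n i ≡ enumD n j → i ≡ j
  enumD-injective {i} {j} eq = begin
    i                  ≡⟨ indexD-enumD i ⟨
    indexD (enumD n i) ≡⟨ cong indexD eq ⟩
    indexD (enumD n j) ≡⟨ indexD-enumD j ⟩
    j                  ∎

  enumD-↑ˡ : ∀ k → enumD n (k ↑ˡ n) ≡ rotation k
  enumD-↑ˡ k rewrite FinP.splitAt-↑ˡ n k n = refl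

  enumD-↑ʳ : ∀ k → enumD n (n ↑ʳ k) ≡ reflection k
  enumD-↑ʳ k rewrite FinP.splitAt-↑ʳ n n k = refl

  module PowerMap (a : ℕ) where

    fC : Fin n → Fin n
    fC x = x ^C a

    fD : D n → D n
    fD x = x ^D a

    LeaderC : Fin n → Set
    LeaderC = Leader FinP._≟_ n (λ i → i) fC

    LeaderD : Fin (n + n) → Set
    LeaderD = Leader (_≟D_ n) (n + n) (enumD n) fD

    iter-fD-↑ˡ : ∀ t k → iter fD t (enumD n (k ↑ˡ n)) ≡ enumD n (iter fC t k ↑ˡ n)
    iter-fD-↑ˡ t k = begin
      iter fD t (enumD n (k ↑ˡ n))  ≡⟨ cong (iter fD t) (enumD-↑ˡ k) ⟩
      iter fD t (rotation k)        ≡⟨ iter-semiconj rotation (λ k → rotation-^ k a) t k ⟩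
      rotation (iter fC t k)        ≡⟨ enumD-↑ˡ (iter fC t k) ⟨
      enumD n (iter fC t k ↑ˡ n)    ∎

    leaderC⇒leaderD : ∀ {i} → LeaderC i → LeaderD (i ↑ˡ n)
    leaderC⇒leaderD {i} ((p , periodic) , least) = (p ↑ˡ n , periodicD) , leastD
      where
      periodicD : iter fD (suc (toℕ (p ↑ˡ n))) (enumD n (i ↑ˡ n)) ≡ enumD n (i ↑ˡ n)
      periodicD rewrite FinP.toℕ-↑ˡ p n =
        trans (iter-fD-↑ˡ (suc (toℕ p)) i) (cong (λ k → enumD n (k ↑ˡ n)) periodic)

      leastD : (t j : Fin (n + n)) → toℕ j < toℕ (i ↑ˡ n) →
               ¬ (enumD n j ≡ iter fD (toℕ t) (enumD n (i ↑ˡ n)))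
      leastD t j j<i eq with s , s<n , eqₛ ← iter-within fC i (toℕ t) =
        least (fromℕ< s<n) c c<i (trans eqₛ (cong (λ u → iter fC u i) (sym (FinP.toℕ-fromℕ< s<n))))
        where
        c : Fin n
        c = iter fC (toℕ t) i
        j≡c : j ≡ c ↑ˡ n
        j≡c = enumD-injective (trans eq (iter-fD-↑ˡ (toℕ t) i))
        c<i : toℕ c < toℕ i
        c<i = subst₂ _<_ (trans (cong toℕ j≡c) (FinP.toℕ-↑ˡ c n)) (FinP.toℕ-↑ˡ i n) j<i

    leaderD⇒leaderC : ∀ {i} → LeaderD (i ↑ˡ n) → LeaderC i
    leaderD⇒leaderC {i} ((p , periodic) , least) = period-within fC i (toℕ p) periodicC , leastC
      where
      periodicC : iter fC (suc (toℕ p)) i ≡ i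
      periodicC = FinP.↑ˡ-injective n _ i
        (enumD-injective (trans (sym (iter-fD-↑ˡ (suc (toℕ p)) i)) periodic))

      leastC : (t j : Fin n) → toℕ j < toℕ i → ¬ (j ≡ iter fC (toℕ t) i)
      leastC t j j<i refl = least (t ↑ˡ n) (j ↑ˡ n) j<i′ (sym orbit)
        where
        j<i′ : toℕ (j ↑ˡ n) < toℕ (i ↑ˡ n)
        j<i′ rewrite FinP.toℕ-↑ˡ j n | FinP.toℕ-↑ˡ i n = j<i
        orbit : iter fD (toℕ (t ↑ˡ n)) (enumD n (i ↑ˡ n)) ≡ enumD n (j ↑ˡ n)
        orbit rewrite FinP.toℕ-↑ˡ t n = iter-fD-↑ˡ (toℕ t) i

    reflection-not-leader : 2 ∣ a → ∀ k → ¬ LeaderD (n ↑ʳ k)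
    reflection-not-leader (divides m refl) k ((p , periodic) , _) with () ← begin
      rotation (iter fC (toℕ p) (zeroC n))           ≡⟨ iter-semiconj rotation (λ k → rotation-^ k a) (toℕ p) (zeroC n) ⟨
      iter fD (toℕ p) (oneD n)                       ≡⟨ cong (iter fD (toℕ p)) (reflection-^-even k m) ⟨
      iter fD (toℕ p) (fD (reflection k))            ≡⟨ iter-sucʳ fD (toℕ p) (reflection k) ⟨
      iter fD (suc (toℕ p)) (reflection k)           ≡⟨ cong (iter fD (suc (toℕ p))) (enumD-↑ʳ k) ⟨
      iter fD (suc (toℕ p)) (enumD n (n ↑ʳ k))       ≡⟨ periodic ⟩
      enumD n (n ↑ʳ k)                               ≡⟨ enumD-↑ʳ k ⟩
      reflection k                                   ∎

    reflection-leader : ¬ 2 ∣ a → ∀ k → LeaderD (n ↑ʳ k)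
    reflection-leader 2∤a k = (n ↑ʳ k , iter-fixed fD fixed (suc (toℕ (n ↑ʳ k)))) , least
      where
      fixed : fD (enumD n (n ↑ʳ k)) ≡ enumD n (n ↑ʳ k)
      fixed rewrite enumD-↑ʳ k =
        trans (cong (reflection k ^D_) (¬2∣m⇒m≡1+[m/2]*2 a 2∤a)) (reflection-^-odd k (a / 2))

      least : (t j : Fin (n + n)) → toℕ j < toℕ (n ↑ʳ k) →
              ¬ (enumD n j ≡ iter fD (toℕ t) (enumD n (n ↑ʳ k)))
      least t j j<k eq =
        <-irrefl (cong toℕ (enumD-injective (trans eq (iter-fixed fD fixed (toℕ t))))) j<k

    leaderC? : Decidable LeaderC
    leaderC? = leader? FinP._≟_ n (λ i → i) fC

    leaderD? : Decidable LeaderD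
    leaderD? = leader? (_≟D_ n) (n + n) (enumD n) fD

    reflectionLeaders : ℕ
    reflectionLeaders = length (filter (leaderD? ∘ (n ↑ʳ_)) (allFin n))

    ND≡NC+reflectionLeaders : ND n a ≡ NC n a + reflectionLeaders
    ND≡NC+reflectionLeaders = trans (length-filter-allFin-+ n n leaderD?)
      (cong (λ xs → length xs + reflectionLeaders)
        (filter-≐ (leaderD? ∘ (_↑ˡ n)) leaderC? (leaderD⇒leaderC , leaderC⇒leaderD) (allFin n)))

    reflectionLeaders-even : 2 ∣ a → reflectionLeaders ≡ 0
    reflectionLeaders-even 2∣a =
      cong length (filter-none (leaderD? ∘ (n ↑ʳ_)) (tabulate⁺ (reflection-not-leader 2∣a)))

    reflectionLeaders-odd : ¬ 2 ∣ a → reflectionLeaders ≡ n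
    reflectionLeaders-odd 2∤a =
      trans (cong length (filter-all (leaderD? ∘ (n ↑ʳ_)) (tabulate⁺ (reflection-leader 2∤a))))
            (length-tabulate (λ i → i))

lemma3p5 : (a n : ℕ) .{{_ : NonZero n}} → 2 ≤ a →
    (2 ∣ a → ND n a ≡ NC n a) × (¬ (2 ∣ a) → ND n a ≡ n + NC n a)
lemma3p5 a n _ = even , odd
  where
  open Dihedral.PowerMap n a
  even : 2 ∣ a → ND n a ≡ NC n a
  even 2∣a = begin
    ND n a                     ≡⟨ ND≡NC+reflectionLeaders ⟩
    NC n a + reflectionLeaders ≡⟨ cong (NC n a +_) (reflectionLeaders-even 2∣a) ⟩
    NC n a + 0                 ≡⟨ +-identityʳ (NC n a) ⟩
    NC n a                     ∎
  odd : ¬ 2 ∣ a → ND n a ≡ n + NC n a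
  odd 2∤a = begin
    ND n a                     ≡⟨ ND≡NC+reflectionLeaders ⟩
    NC n a + reflectionLeaders ≡⟨ cong (NC n a +_) (reflectionLeaders-odd 2∤a) ⟩
    NC n a + n                 ≡⟨ +-comm (NC n a) n ⟩
    n + NC n a                 ∎
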